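{- Let $b,n_1,n_2$ be positive integers. Suppose $R_1=I_1\times J_0$ and $R_2=I_2\times J_0$ are rectangles in $\mathbb{Z}_{n_1}\times\mathbb{Z}_{n_2}$ (with $I_1,I_2$ intervals in $\mathbb{Z}_{n_1}$ and $J_0$ an interval in $\mathbb{Z}_{n_2}$) forming a $b$-blocking pair with base $J_0$, i.e. $d(I_1,I_2)\geq b+1$. Let $U\subset\mathbb{Z}_{n_1}$ and $V\subset\mathbb{Z}_{n_2}$ be intervals with $1\leq|U|,|V|\leq b$, and suppose that $R_1$, $R_2$ and $U\times V$ are pairwise proj-intersecting. Then $J_0\cap V\neq\emptyset$.
   Context: For $u,v\in\mathbb{Z}_n$ the distance $d(u,v)$ is the smaller of $(u-v)\bmod n$ and $(v-u)\bmod n$. An interval of length $a$ in $\mathbb{Z}_n$ is a set $\{i+1,\ldots,i+a\}$ (mod $n$); the distance of two intervals is the minimum distance between an element of one and an element of the other. A rectangle is a product $I\times J$ of an interval $I$ in $\mathbb{Z}_{n_1}$ and an interval $J$ in $\mathbb{Z}_{n_2}$. Rectangles $I\times J$ and $I'\times J'$ are proj-intersecting if $I\cap I'\neq\emptyset$ or $J\cap J'\neq\emptyset$. -}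

module Defs where

open import Data.Nat using (ℕ; _+_; _∸_; _≤_; _⊓_; NonZero)
open import Data.Nat.DivMod using (_%_)
open import Data.Fin using (Fin; toℕ)
open import Data.Product using (∃-syntax; _×_)
open import Data.Sum using (_⊎_)
open import Relation.Binary.PropositionalEquality using (_≡_)

-- ℤ_n is represented by Fin n (residues 0,…,n-1).

dist : (n : ℕ) .{{_ : NonZero n}} → Fin n → Fin n → ℕ
dist n u v = ((toℕ u + n ∸ toℕ v) % n) ⊓ ((toℕ v + n ∸ toℕ u) % n)

-- An interval {i+1,…,i+a} (mod n) of length a, 1 ≤ a ≤ n.
record Interval (n : ℕ) : Set where
  constructor interval
  field
    start  : ℕ
    len    : ℕ
    len≥1  : 1 ≤ len
    len≤n  : len ≤ n
open Interval public

_∈I_ : {n : ℕ} .{{_ : NonZero n}} → Fin n → Interval n → Set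
_∈I_ {n} x I = ∃[ k ] (1 ≤ k × k ≤ len I × toℕ x ≡ (start I + k) % n)

Meets : {n : ℕ} .{{_ : NonZero n}} → Interval n → Interval n → Set
Meets {n} I I' = ∃[ x ] (x ∈I I × x ∈I I')

DistGe : (n : ℕ) .{{_ : NonZero n}} → ℕ → Interval n → Interval n → Set
DistGe n m I I' = ∀ (x y : Fin n) → x ∈I I → y ∈I I' → m ≤ dist n x y

record Rect (n₁ n₂ : ℕ) : Set where
  constructor _⊠_
  field
    horiz : Interval n₁
    vert  : Interval n₂
open Rect public

ProjIntersecting : {n₁ n₂ : ℕ} .{{_ : NonZero n₁}} .{{_ : NonZero n₂}} →
                   Rect n₁ n₂ → Rect n₁ n₂ → Set
ProjIntersecting R R' = Meets (horiz R) (horiz R') ⊎ Meets (vert R) (vert R')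

-- Two points of an interval U are at distance less than |U| ≤ b, whereas I₁ and
-- I₂ are at distance at least b + 1; so U cannot meet both of them, and one of
-- R₁, R₂ must meet U × V in the second coordinate, i.e. J₀ meets V.
module Submission where

open import Defs
open import Data.Nat using (ℕ; _+_; _*_; _∸_; _≤_; _<_; NonZero)
open import Data.Nat.Properties
open import Data.Nat.DivMod using (_%_; _/_; m≡m%n+[m/n]*n; [m+n]%n≡m%n; [m+kn]%n≡m%n;
  %-distribˡ-+; m%n%n≡m%n; m%n<n; m%n≤m)
open import Data.Nat.Tactic.RingSolver using (solve-∀)
open import Data.Fin using (Fin; toℕ)
open import Data.Product using (_,_)
open import Data.Sum using (inj₁; inj₂)
open import Relation.Nullary using (contradiction)
open import Relation.Binary.PropositionalEquality using (_≡_; sym; trans; cong; cong₂; subst; module ≡-Reasoning)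

[[m+n]%k+k∸m]%k≡n%k : ∀ m n k .{{_ : NonZero k}} → m ≤ k →
                      ((m + n) % k + k ∸ m) % k ≡ n % k
[[m+n]%k+k∸m]%k≡n%k m n k m≤k = begin
  (r + k ∸ m) % k            ≡⟨ [m+kn]%n≡m%n (r + k ∸ m) q k ⟨
  (r + k ∸ m + q * k) % k    ≡⟨ cong (_% k) (+-∸-comm (q * k) (≤-trans m≤k (m≤n+m k r))) ⟨
  (r + k + q * k ∸ m) % k    ≡⟨ cong (λ t → (t ∸ m) % k) (swap r k (q * k)) ⟩
  (r + q * k + k ∸ m) % k    ≡⟨ cong (λ t → (t + k ∸ m) % k) (m≡m%n+[m/n]*n (m + n) k) ⟨
  (m + n + k ∸ m) % k        ≡⟨ cong (λ t → (t ∸ m) % k) (+-assoc m n k) ⟩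
  (m + (n + k) ∸ m) % k      ≡⟨ cong (_% k) (m+n∸m≡n m (n + k)) ⟩
  (n + k) % k                ≡⟨ [m+n]%n≡m%n n k ⟩
  n % k                      ∎
  where
  open ≡-Reasoning
  r = (m + n) % k
  q = (m + n) / k
  swap : ∀ a b c → a + b + c ≡ a + c + b
  swap = solve-∀

[[m+n]%k+k∸m%k]%k≡n%k : ∀ m n k .{{_ : NonZero k}} →
                        ((m + n) % k + k ∸ m % k) % k ≡ n % k
[[m+n]%k+k∸m%k]%k≡n%k m n k = begin
  ((m + n) % k + k ∸ m % k) % k         ≡⟨ cong (λ t → (t + k ∸ m % k) % k) reduce-m ⟩
  ((m % k + n) % k + k ∸ m % k) % k     ≡⟨ [[m+n]%k+k∸m]%k≡n%k (m % k) n k (<⇒≤ (m%n<n m k)) ⟩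
  n % k                                 ∎
  where
  open ≡-Reasoning
  reduce-m : (m + n) % k ≡ (m % k + n) % k
  reduce-m = begin
    (m + n) % k                 ≡⟨ %-distribˡ-+ m n k ⟩
    (m % k + n % k) % k         ≡⟨ cong (λ t → (t + n % k) % k) (m%n%n≡m%n m k) ⟨
    (m % k % k + n % k) % k     ≡⟨ %-distribˡ-+ (m % k) n k ⟨
    (m % k + n) % k             ∎

dist-comm : ∀ n .{{_ : NonZero n}} (x y : Fin n) → dist n x y ≡ dist n y x
dist-comm n x y = ⊓-comm ((toℕ x + n ∸ toℕ y) % n) ((toℕ y + n ∸ toℕ x) % n)

dist≤∸ : ∀ n .{{_ : NonZero n}} (s : ℕ) {k k′ : ℕ} (x y : Fin n) → k ≤ k′ →
         toℕ x ≡ (s + k) % n → toℕ y ≡ (s + k′) % n → dist n x y ≤ k′ ∸ k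
dist≤∸ n s {k} {k′} x y k≤k′ x≡ y≡ = begin
  dist n x y                              ≤⟨ m⊓n≤n _ _ ⟩
  (toℕ y + n ∸ toℕ x) % n                 ≡⟨ cong₂ (λ a c → (a + n ∸ c) % n) y≡ x≡ ⟩
  ((s + k′) % n + n ∸ (s + k) % n) % n    ≡⟨ cong (λ t → (t % n + n ∸ (s + k) % n) % n) s+k′≡ ⟩
  ((s + k + d) % n + n ∸ (s + k) % n) % n ≡⟨ [[m+n]%k+k∸m%k]%k≡n%k (s + k) d n ⟩
  d % n                                   ≤⟨ m%n≤m d n ⟩
  d                                       ∎
  where
  open ≤-Reasoning
  d = k′ ∸ k
  s+k′≡ : s + k′ ≡ s + k + d
  s+k′≡ = trans (cong (s +_) (sym (m+[n∸m]≡n k≤k′))) (sym (+-assoc s k d))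

module _ {n : ℕ} .{{_ : NonZero n}} (U : Interval n) where

  dist<len-ordered : ∀ (x y : Fin n) {k k′} → 1 ≤ k → k ≤ k′ → k′ ≤ len U →
                     toℕ x ≡ (start U + k) % n → toℕ y ≡ (start U + k′) % n → dist n x y < len U
  dist<len-ordered x y {k} {k′} 1≤k k≤k′ k′≤len x≡ y≡ = begin-strict
    dist n x y  ≤⟨ dist≤∸ n (start U) x y k≤k′ x≡ y≡ ⟩
    k′ ∸ k      <⟨ ∸-monoʳ-< 1≤k k≤k′ ⟩
    k′          ≤⟨ k′≤len ⟩
    len U       ∎
    where open ≤-Reasoning hiding (start)

  dist<len : ∀ (x y : Fin n) → x ∈I U → y ∈I U → dist n x y < len U
  dist<len x y (k , 1≤k , k≤len , x≡) (k′ , 1≤k′ , k′≤len , y≡) with ≤-total k k′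
  ... | inj₁ k≤k′ = dist<len-ordered x y 1≤k k≤k′ k′≤len x≡ y≡
  ... | inj₂ k′≤k = subst (_< len U) (dist-comm n y x) (dist<len-ordered y x 1≤k′ k′≤k k≤len y≡ x≡)

lemma4 : (b n₁ n₂ : ℕ) → .{{_ : NonZero b}} → .{{_ : NonZero n₁}} → .{{_ : NonZero n₂}} →
    (I₁ I₂ : Interval n₁) (J₀ : Interval n₂) (U : Interval n₁) (V : Interval n₂) →
    DistGe n₁ (b + 1) I₁ I₂ →
    len U ≤ b → len V ≤ b →
    ProjIntersecting (I₁ ⊠ J₀) (I₂ ⊠ J₀) →
    ProjIntersecting (I₁ ⊠ J₀) (U ⊠ V) →
    ProjIntersecting (I₂ ⊠ J₀) (U ⊠ V) →
    Meets J₀ V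
lemma4 _ _ _ _ _ _ _ _ _ _ _ _ (inj₂ J₀∩V) _ = J₀∩V
lemma4 _ _ _ _ _ _ _ _ _ _ _ _ (inj₁ _) (inj₂ J₀∩V) = J₀∩V
lemma4 b n₁ _ _ _ _ U _ I₁I₂-far |U|≤b _ _ (inj₁ (x , x∈I₁ , x∈U)) (inj₁ (y , y∈I₂ , y∈U)) =
  contradiction (I₁I₂-far x y x∈I₁ y∈I₂)
                (<⇒≱ (<-≤-trans (dist<len U x y x∈U y∈U) (≤-trans |U|≤b (m≤m+n b 1))))
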